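{- Let $G$ be a disconnected graph with exactly one nontrivial connected component $G_1$ and $t > 0$ trivial components, and let $\overline{G}_1$ be the subgraph of $\overline{G}$ induced by the vertices corresponding to $V(G_1)$ (i.e. the complement of $G_1$). If $\mathrm{diam}(G_1) \leq 3$ and $\mathrm{diam}(\overline{G}_1) \leq 2$, then $h(G\overline{G}) \leq \min\{h(G_1), h(\overline{G}_1)\} + t$.
   Context: All graphs are finite, simple and undirected. For a graph $H$ and $x,y \in V(H)$, the closed interval $I[x,y]$ consists of $x$, $y$ and all vertices lying on some shortest path between $x$ and $y$ in $H$; for $S \subseteq V(H)$, $I[S] = \bigcup_{x,y\in S} I[x,y]$. A set $S$ is (geodetically) convex if $I[S]=S$; the convex hull $H(S)$ is the smallest convex set containing $S$; $S$ is a hull set if $H(S)=V(H)$; the (geodetic) hull number $h(H)$ is the minimum cardinality of a hull set of $H$ (hull numbers of $G_1$ and $\overline{G}_1$ are taken in those graphs on their own). $\mathrm{diam}$ denotes the diameter. For a graph $G$ with vertex set $\{v_1,\dots,v_n\}$, the complementary prism $G\overline{G}$ has vertex set $\{v_1,\dots,v_n\}\cup\{\overline{v}_1,\dots,\overline{v}_n\}$ and edge set $E(G) \cup \{\overline{v}_i\overline{v}_j : i<j,\ v_iv_j\notin E(G)\} \cup \{v_i\overline{v}_i : 1\le i\le n\}$; $\overline{v}_i$ is the vertex corresponding to $v_i$. A component is trivial if it has exactly one vertex, nontrivial otherwise. -}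

module Defs where

open import Data.Bool using (Bool; true; false; not; _∧_)
open import Data.Fin using (Fin; splitAt; _≟_)
open import Data.Fin.Subset using (Subset; _∈_; _∉_; _⊆_; ∣_∣; ∁)
open import Data.Nat using (ℕ; zero; suc; _+_; _≤_; _<_)
open import Data.Product using (Σ; _×_; ∃)
open import Data.Sum using (_⊎_; inj₁; inj₂)
open import Relation.Binary.PropositionalEquality using (_≡_)
open import Relation.Nullary using (¬_)
open import Relation.Nullary.Decidable using (⌊_⌋)

Adjacency : ℕ → Set
Adjacency n = Fin n → Fin n → Bool

IsSimple : ∀ {n} → Adjacency n → Set
IsSimple {n} A = (∀ (x y : Fin n) → A x y ≡ A y x) × (∀ (x : Fin n) → A x x ≡ false)

complement : ∀ {n} → Adjacency n → Adjacency n
complement A x y = not (A x y) ∧ not ⌊ x ≟ y ⌋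

-- Complementary prism G Ḡ on Fin (n + n): the first copy (inj₁ v) is v, the
-- second copy (inj₂ v) is v̄.
prismAdj : ∀ {n} → Adjacency n → (Fin n ⊎ Fin n) → (Fin n ⊎ Fin n) → Bool
prismAdj A (inj₁ a) (inj₁ b) = A a b
prismAdj A (inj₂ a) (inj₂ b) = complement A a b
prismAdj A (inj₁ a) (inj₂ b) = ⌊ a ≟ b ⌋
prismAdj A (inj₂ a) (inj₁ b) = ⌊ a ≟ b ⌋

complementaryPrism : ∀ {n} → Adjacency n → Adjacency (n + n)
complementaryPrism {n} A i j = prismAdj A (splitAt n i) (splitAt n j)

-- All notions below are taken in the subgraph induced by a vertex set W
-- (W = everything for the whole graph).

data Walk {n} (A : Adjacency n) (W : Subset n) : Fin n → Fin n → ℕ → Set where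
  here : ∀ {x} → x ∈ W → Walk A W x x zero
  step : ∀ {x y z k} → x ∈ W → A x y ≡ true → Walk A W y z k → Walk A W x z (suc k)

Dist : ∀ {n} → Adjacency n → Subset n → Fin n → Fin n → ℕ → Set
Dist A W x y d = Walk A W x y d × (∀ k → k < d → ¬ Walk A W x y k)

-- z ∈ I[x,y]: z is x, y, or lies on a shortest x–y path
-- (an x–z walk followed by a z–y walk whose total length is d(x,y)).
InInterval : ∀ {n} → Adjacency n → Subset n → Fin n → Fin n → Fin n → Set
InInterval A W x y z =
  z ≡ x ⊎ (z ≡ y ⊎ Σ ℕ λ a → Σ ℕ λ b →
    Walk A W x z a × Walk A W z y b × Dist A W x y (a + b))

Convex : ∀ {n} → Adjacency n → Subset n → Subset n → Set
Convex {n} A W T = ∀ (x y z : Fin n) → x ∈ T → y ∈ T → InInterval A W x y z → z ∈ T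

-- S is a hull set: its convex hull (the smallest convex set containing S,
-- i.e. the intersection of all convex sets containing S) is all of W.
IsHullSet : ∀ {n} → Adjacency n → Subset n → Subset n → Set
IsHullSet {n} A W S = ∀ (T : Subset n) → T ⊆ W → S ⊆ T → Convex A W T → W ⊆ T

IsHullNumber : ∀ {n} → Adjacency n → Subset n → ℕ → Set
IsHullNumber {n} A W h =
  (Σ (Subset n) λ S → S ⊆ W × IsHullSet A W S × ∣ S ∣ ≡ h)
  × (∀ (S : Subset n) → S ⊆ W → IsHullSet A W S → h ≤ ∣ S ∣)

DiamAtMost : ∀ {n} → Adjacency n → Subset n → ℕ → Set
DiamAtMost {n} A W k = ∀ (x y : Fin n) → x ∈ W → y ∈ W →
  Σ ℕ λ d → Dist A W x y d × d ≤ k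

IsComponent : ∀ {n} → Adjacency n → Subset n → Set
IsComponent {n} A C =
  (Σ (Fin n) λ v → v ∈ C)
  × (∀ (x y : Fin n) → x ∈ C → y ∈ C → ∃ λ k → Walk A C x y k)
  × (∀ (x y : Fin n) → x ∈ C → y ∉ C → A x y ≡ false)

-- G has exactly one nontrivial component C and every other vertex is isolated
-- (a trivial component); t = number of trivial components.
OneNontrivialComponent : ∀ {n} → Adjacency n → Subset n → ℕ → Set
OneNontrivialComponent {n} A C t =
  IsComponent A C × 2 ≤ ∣ C ∣
  × (∀ (x y : Fin n) → x ∉ C → A x y ≡ false)
  × ∣ ∁ C ∣ ≡ t

module Submission where

-- Write v for the copy of a vertex in G and v̄ for its copy in Ḡ.
-- If diam(G₁) ≤ 3 then v ↦ v is distance preserving from G₁ into GḠ, and if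
-- diam(Ḡ₁) ≤ 2 then v ↦ v̄ is distance preserving from Ḡ₁ into GḠ.  The
-- preimage of a convex set under a distance-preserving embedding is convex,
-- so a convex set of GḠ containing the image of a hull set of G₁ (resp. Ḡ₁)
-- contains the image of all of C.  Adding the t isolated vertices u to a hull
-- set S of G₁ or of Ḡ₁ then gives a hull set of GḠ: for u isolated and
-- v ∈ C the path u ū v̄ v is a shortest path, which puts ū and v̄ into the hull,
-- and the path w v v̄ (for an edge wv of G) is a shortest path, which
-- propagates the copies of C in G along G₁ once all v̄ are present.

open import Defs
open import Data.Nat using (ℕ; _+_; _≤_; _<_; _⊓_)
open import Data.Fin.Subset using (Subset; ⊤)

open import Data.Nat using (zero; suc; z≤n; s≤s)
open import Data.Nat.Properties
  using (≤-trans; ≤-refl; <-cmp; ≤-<-trans; ≤-pred; <-irrefl; +-monoʳ-≤; n≤1+n; +-suc; ≤-total;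
         m≤n⇒m⊓n≡m; m≥n⇒m⊓n≡n)
open import Data.Bool using (true; false)
open import Data.Bool.Properties using (T-≡)
open import Data.Fin using (Fin; splitAt; _≟_; _↑ˡ_; _↑ʳ_; join)
open import Data.Fin.Properties using (splitAt-↑ˡ; splitAt-↑ʳ; join-splitAt)
open import Data.Fin.Subset using (_∈_; _∉_; _⊆_; ∣_∣; ∁; _∪_; _∩_; ⊥; Nonempty)
open import Data.Fin.Subset.Properties
  using (_∈?_; ∈⊤; ∉⊥; ⊥⊆; ∣⊥∣≡0; nonempty?; Empty-unique; x∈p∪q⁺; x∈p∩q⁺; x∈p∩q⁻;
         x∉p⇒x∈∁p; x∈∁p⇒x∉p)
open import Data.Vec using ([]; _∷_; _++_; tabulate)
open import Data.Vec.Properties using (lookup⇒[]=; []=⇒lookup; lookup∘tabulate; lookup-++ˡ)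
open import Data.Product using (_×_; _,_; proj₁; proj₂; ∃)
open import Data.Sum using (_⊎_; inj₁; inj₂)
open import Data.Empty using (⊥-elim)
open import Function.Bundles using (Equivalence)
open import Relation.Binary.Definitions using (tri<; tri≈; tri>)
open import Relation.Binary.PropositionalEquality using (_≡_; _≢_; refl; sym; trans; cong; subst; subst₂)
open import Relation.Nullary using (¬_; Dec; yes; no; contradiction)
open import Relation.Nullary.Decidable using (⌊_⌋; toWitness; isYes≗does; dec-true; dec-false)
open import Relation.Unary using (Decidable)

isYes⁺ : ∀ {P : Set} (d : Dec P) → P → ⌊ d ⌋ ≡ true
isYes⁺ d p = trans (isYes≗does d) (dec-true d p)

isYes⁻ : ∀ {P : Set} (d : Dec P) → ⌊ d ⌋ ≡ true → P
isYes⁻ d e = toWitness {a? = d} (Equivalence.from T-≡ e)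

isNo⁺ : ∀ {P : Set} (d : Dec P) → ¬ P → ⌊ d ⌋ ≡ false
isNo⁺ d ¬p = trans (isYes≗does d) (dec-false d ¬p)

subsetOf : ∀ {m} {P : Fin m → Set} → Decidable P → Subset m
subsetOf P? = tabulate (λ x → ⌊ P? x ⌋)

∈-subsetOf⁺ : ∀ {m} {P : Fin m → Set} (P? : Decidable P) {x} → P x → x ∈ subsetOf P?
∈-subsetOf⁺ P? {x} p = lookup⇒[]= x _ (trans (lookup∘tabulate _ x) (isYes⁺ (P? x) p))

∈-subsetOf⁻ : ∀ {m} {P : Fin m → Set} (P? : Decidable P) {x} → x ∈ subsetOf P? → P x
∈-subsetOf⁻ P? {x} x∈ = isYes⁻ (P? x) (trans (sym (lookup∘tabulate _ x)) ([]=⇒lookup x∈))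

∈-++ˡ : ∀ {m k} (p : Subset m) (q : Subset k) {x} → x ∈ p → (x ↑ˡ k) ∈ (p ++ q)
∈-++ˡ p q {x} x∈p = lookup⇒[]= _ (p ++ q) (trans (lookup-++ˡ p q x) ([]=⇒lookup x∈p))

∣p++⊥∣≡∣p∣ : ∀ {m k} (p : Subset m) → ∣ p ++ ⊥ {n = k} ∣ ≡ ∣ p ∣
∣p++⊥∣≡∣p∣ {k = k} [] = ∣⊥∣≡0 k
∣p++⊥∣≡∣p∣ (true ∷ p) = cong suc (∣p++⊥∣≡∣p∣ p)
∣p++⊥∣≡∣p∣ (false ∷ p) = ∣p++⊥∣≡∣p∣ p

∣p∪q∣≤∣p∣+∣q∣ : ∀ {m} (p q : Subset m) → ∣ p ∪ q ∣ ≤ ∣ p ∣ + ∣ q ∣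
∣p∪q∣≤∣p∣+∣q∣ [] [] = z≤n
∣p∪q∣≤∣p∣+∣q∣ (true ∷ p) (true ∷ q) = s≤s (≤-trans (∣p∪q∣≤∣p∣+∣q∣ p q) (+-monoʳ-≤ ∣ p ∣ (n≤1+n _)))
∣p∪q∣≤∣p∣+∣q∣ (true ∷ p) (false ∷ q) = s≤s (∣p∪q∣≤∣p∣+∣q∣ p q)
∣p∪q∣≤∣p∣+∣q∣ (false ∷ p) (true ∷ q) =
  subst (suc ∣ p ∪ q ∣ ≤_) (sym (+-suc ∣ p ∣ ∣ q ∣)) (s≤s (∣p∪q∣≤∣p∣+∣q∣ p q))
∣p∪q∣≤∣p∣+∣q∣ (false ∷ p) (false ∷ q) = ∣p∪q∣≤∣p∣+∣q∣ p q

positive⇒nonempty : ∀ {m} (p : Subset m) → 0 < ∣ p ∣ → Nonempty p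
positive⇒nonempty {m} p 0<∣p∣ with nonempty? p
... | yes ne = ne
... | no ¬ne = contradiction (subst (0 <_) (∣⊥∣≡0 m) (subst (λ q → 0 < ∣ q ∣) (Empty-unique ¬ne) 0<∣p∣))
                             (<-irrefl refl)

module _ {n : ℕ} {X : Adjacency n} {W : Subset n} where

  walk-source : ∀ {x y k} → Walk X W x y k → x ∈ W
  walk-source (here x∈W) = x∈W
  walk-source (step x∈W _ _) = x∈W

  walk-target : ∀ {x y k} → Walk X W x y k → y ∈ W
  walk-target (here y∈W) = y∈W
  walk-target (step _ _ w) = walk-target w

  walk₀ : ∀ {x y} → Walk X W x y 0 → x ≡ y
  walk₀ (here _) = refl

  walk₁ : ∀ {x y} → Walk X W x y 1 → X x y ≡ true
  walk₁ (step _ e (here _)) = e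

  walk₂ : ∀ {x y} → Walk X W x y 2 → ∃ λ m → X x m ≡ true × X m y ≡ true
  walk₂ (step _ e (step _ e′ (here _))) = _ , e , e′

  dist-unique : ∀ {x y d d′} → Dist X W x y d → Dist X W x y d′ → d ≡ d′
  dist-unique {d = d} {d′} (w , short) (w′ , short′) with <-cmp d d′
  ... | tri< d<d′ _ _ = ⊥-elim (short′ d d<d′ w)
  ... | tri≈ _ d≡d′ _ = d≡d′
  ... | tri> _ _ d′<d = ⊥-elim (short d′ d′<d w′)

  dist-≤-diam : ∀ {x y d k} → DiamAtMost X W k → Dist X W x y d → d ≤ k
  dist-≤-diam diam D with diam _ _ (walk-source (proj₁ D)) (walk-target (proj₁ D))
  ... | d′ , D′ , d′≤k = subst (_≤ _) (dist-unique D′ D) d′≤k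

  interval-inside : ∀ {x y z} → x ∈ W → y ∈ W → InInterval X W x y z → z ∈ W
  interval-inside x∈W _ (inj₁ refl) = x∈W
  interval-inside _ y∈W (inj₂ (inj₁ refl)) = y∈W
  interval-inside _ _ (inj₂ (inj₂ (_ , _ , _ , wzy , _))) = walk-source wzy

  convex-geodesic : ∀ {K x y z a b} → Convex X W K → x ∈ K → y ∈ K →
    Walk X W x z a → Walk X W z y b → Dist X W x y (a + b) → z ∈ K
  convex-geodesic convK x∈K y∈K wxz wzy D =
    convK _ _ _ x∈K y∈K (inj₂ (inj₂ (_ , _ , wxz , wzy , D)))

  -- A hull set of a nonempty vertex set is nonempty (the empty set is convex).
  hull-nonempty : ∀ {S x} → IsHullSet X W S → x ∈ W → Nonempty S
  hull-nonempty {S} hull x∈W with nonempty? S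
  ... | yes ne = ne
  ... | no ¬ne = ⊥-elim (∉⊥ (hull ⊥ ⊥⊆ S⊆⊥ ⊥-convex x∈W))
    where
    S⊆⊥ : S ⊆ ⊥
    S⊆⊥ s∈S = ⊥-elim (¬ne (_ , s∈S))
    ⊥-convex : Convex X W ⊥
    ⊥-convex _ _ _ x∈⊥ = ⊥-elim (∉⊥ x∈⊥)

EdgePreserving : ∀ {n m} → (Fin n → Fin m) → Adjacency n → Adjacency m → Set
EdgePreserving f X Y = ∀ x y → X x y ≡ true → Y (f x) (f y) ≡ true

DistancePreserving : ∀ {n m} → (Fin n → Fin m) → Adjacency n → Subset n → Adjacency m → Set
DistancePreserving f X W Y = ∀ {x y d} → Dist X W x y d → Dist Y ⊤ (f x) (f y) d

ShortWalksPullBack : ∀ {n m} → (Fin n → Fin m) → Adjacency n → Subset n → Adjacency m → Set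
ShortWalksPullBack f X W Y = ∀ {x y d k} → Dist X W x y d → k < d →
  Walk Y ⊤ (f x) (f y) k → ∃ λ k′ → k′ ≤ k × Walk X W x y k′

module _ {n m : ℕ} {X : Adjacency n} {W : Subset n} {Y : Adjacency m}
         {f : Fin n → Fin m} (f-edge : EdgePreserving f X Y) where

  map-walk : ∀ {x y k} → Walk X W x y k → Walk Y ⊤ (f x) (f y) k
  map-walk (here _) = here ∈⊤
  map-walk (step _ e w) = step ∈⊤ (f-edge _ _ e) (map-walk w)

  -- Walks map forward, so distances can only shrink; pulling back short walks
  -- shows that they do not.
  distance-preserving : ShortWalksPullBack f X W Y → DistancePreserving f X W Y
  distance-preserving pull D@(w , short) = map-walk w , no-shorter
    where
    no-shorter : ∀ k → k < _ → ¬ Walk Y ⊤ _ _ k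
    no-shorter k k<d wY with pull D k<d wY
    ... | k′ , k′≤k , wX = short k′ (≤-<-trans k′≤k k<d) wX

  module _ (f-dist : DistancePreserving f X W Y) where

    interval-image : ∀ {x y z} → InInterval X W x y z → InInterval Y ⊤ (f x) (f y) (f z)
    interval-image (inj₁ refl) = inj₁ refl
    interval-image (inj₂ (inj₁ refl)) = inj₂ (inj₁ refl)
    interval-image (inj₂ (inj₂ (a , b , wxz , wzy , D))) =
      inj₂ (inj₂ (a , b , map-walk wxz , map-walk wzy , f-dist D))

    convex-preimage : ∀ {K} → Convex Y ⊤ K → Convex X W (W ∩ subsetOf (λ x → f x ∈? K))
    convex-preimage {K} convK x y z x∈T y∈T I =
      x∈p∩q⁺ (interval-inside x∈W y∈W I ,
              ∈-subsetOf⁺ (λ v → f v ∈? K) (convK _ _ _ fx∈K fy∈K (interval-image I)))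
      where
      x∈W : x ∈ W
      x∈W = proj₁ (x∈p∩q⁻ W _ x∈T)
      y∈W : y ∈ W
      y∈W = proj₁ (x∈p∩q⁻ W _ y∈T)
      fx∈K : f x ∈ K
      fx∈K = ∈-subsetOf⁻ (λ v → f v ∈? K) (proj₂ (x∈p∩q⁻ W _ x∈T))
      fy∈K : f y ∈ K
      fy∈K = ∈-subsetOf⁻ (λ v → f v ∈? K) (proj₂ (x∈p∩q⁻ W _ y∈T))

    hull-image : ∀ {S K} → S ⊆ W → IsHullSet X W S → Convex Y ⊤ K →
      (∀ {s} → s ∈ S → f s ∈ K) → ∀ {x} → x ∈ W → f x ∈ K
    hull-image {S} {K} S⊆W hull convK fS⊆K x∈W =
      ∈-subsetOf⁻ (λ v → f v ∈? K) (proj₂ (x∈p∩q⁻ W _ (hull T T⊆W S⊆T (convex-preimage convK) x∈W)))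
      where
      T : Subset n
      T = W ∩ subsetOf (λ v → f v ∈? K)
      T⊆W : T ⊆ W
      T⊆W x∈T = proj₁ (x∈p∩q⁻ W _ x∈T)
      S⊆T : S ⊆ T
      S⊆T s∈S = x∈p∩q⁺ (S⊆W s∈S , ∈-subsetOf⁺ (λ v → f v ∈? K) (fS⊆K s∈S))

EdgeClosed : ∀ {n} → Adjacency n → Subset n → Set
EdgeClosed {n} X W = ∀ (x y : Fin n) → x ∈ W → X x y ≡ true → y ∈ W

no-edge-out⇒closed : ∀ {n} {X : Adjacency n} {W : Subset n} →
  (∀ (x y : Fin n) → x ∈ W → y ∉ W → X x y ≡ false) → EdgeClosed X W
no-edge-out⇒closed {W = W} no-out x y x∈W e with y ∈? W
... | yes y∈W = y∈W
... | no y∉W with trans (sym e) (no-out x y x∈W y∉W)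
...   | ()

module Prism {n : ℕ} (A : Adjacency n) where

  P : Adjacency (n + n)
  P = complementaryPrism A

  base bar : Fin n → Fin (n + n)
  base x = x ↑ˡ n
  bar x = n ↑ʳ x

  split-base : ∀ x → splitAt n (base x) ≡ inj₁ x
  split-base x = splitAt-↑ˡ n x n

  split-bar : ∀ x → splitAt n (bar x) ≡ inj₂ x
  split-bar x = splitAt-↑ʳ n n x

  P-base-any : ∀ x i → P (base x) i ≡ prismAdj A (inj₁ x) (splitAt n i)
  P-base-any x i rewrite split-base x = refl

  P-any-base : ∀ i x → P i (base x) ≡ prismAdj A (splitAt n i) (inj₁ x)
  P-any-base i x rewrite split-base x = refl

  P-base-base : ∀ x y → P (base x) (base y) ≡ A x y
  P-base-base x y rewrite split-base x | split-base y = refl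

  P-bar-bar : ∀ x y → P (bar x) (bar y) ≡ complement A x y
  P-bar-bar x y rewrite split-bar x | split-bar y = refl

  P-base-bar : ∀ x y → P (base x) (bar y) ≡ ⌊ x ≟ y ⌋
  P-base-bar x y rewrite split-base x | split-bar y = refl

  P-bar-base : ∀ x y → P (bar x) (base y) ≡ ⌊ x ≟ y ⌋
  P-bar-base x y rewrite split-bar x | split-base y = refl

  base-bar-edge : ∀ x → P (base x) (bar x) ≡ true
  base-bar-edge x = trans (P-base-bar x x) (isYes⁺ (x ≟ x) refl)

  bar-base-edge : ∀ x → P (bar x) (base x) ≡ true
  bar-base-edge x = trans (P-bar-base x x) (isYes⁺ (x ≟ x) refl)

  base-injective : ∀ {x y} → base x ≡ base y → x ≡ y
  base-injective {x} {y} e with trans (sym (split-base x)) (trans (cong (splitAt n) e) (split-base y))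
  ... | refl = refl

  bar-injective : ∀ {x y} → bar x ≡ bar y → x ≡ y
  bar-injective {x} {y} e with trans (sym (split-bar x)) (trans (cong (splitAt n) e) (split-bar y))
  ... | refl = refl

  base≢bar : ∀ {x y} → base x ≢ bar y
  base≢bar {x} {y} e with trans (sym (split-base x)) (trans (cong (splitAt n) e) (split-bar y))
  ... | ()

  base-edge : EdgePreserving base A P
  base-edge x y e = trans (P-base-base x y) e

  bar-edge : EdgePreserving bar (complement A) P
  bar-edge x y e = trans (P-bar-bar x y) e

  prism-cover : ∀ {K : Subset (n + n)} → (∀ x → base x ∈ K) → (∀ x → bar x ∈ K) → ∀ i → i ∈ K
  prism-cover {K} base∈K bar∈K i = subst (_∈ K) (join-splitAt n n i) (by-side (splitAt n i))
    where
    by-side : (s : Fin n ⊎ Fin n) → join n n s ∈ K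
    by-side (inj₁ x) = base∈K x
    by-side (inj₂ x) = bar∈K x

  -- A walk of length ≤ 2 in G Ḡ between base vertices either stays in G
  -- or is x x̄ x; so inside an edge-closed W it yields an A[W]-walk no longer.
  short-base-walk : ∀ {W} → EdgeClosed A W → ∀ {x y k} → x ∈ W → k ≤ 2 →
    Walk P ⊤ (base x) (base y) k → ∃ λ k′ → k′ ≤ k × Walk A W x y k′
  short-base-walk closed {k = zero} x∈W _ w with base-injective (walk₀ w)
  ... | refl = 0 , z≤n , here x∈W
  short-base-walk closed {x} {y} {suc zero} x∈W _ w =
    1 , ≤-refl , step x∈W e (here (closed x y x∈W e))
    where
    e : A x y ≡ true
    e = trans (sym (P-base-base x y)) (walk₁ w)
  short-base-walk closed {x} {y} {suc (suc zero)} x∈W _ w with walk₂ w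
  ... | i , e₁ , e₂ = via (splitAt n i) (trans (sym (P-base-any x i)) e₁) (trans (sym (P-any-base i y)) e₂)
    where
    via : (s : Fin n ⊎ Fin n) → prismAdj A (inj₁ x) s ≡ true → prismAdj A s (inj₁ y) ≡ true →
          ∃ λ k′ → k′ ≤ 2 × Walk A _ x y k′
    via (inj₁ m) e e′ = 2 , ≤-refl , step x∈W e (step m∈W e′ (here (closed m y m∈W e′)))
      where
      m∈W : m ∈ _
      m∈W = closed x m x∈W e
    via (inj₂ m) e e′ with isYes⁻ (x ≟ m) e | isYes⁻ (m ≟ y) e′
    ... | refl | refl = 0 , z≤n , here x∈W
  short-base-walk closed {k = suc (suc (suc _))} _ (s≤s (s≤s ())) _

  base-distance-preserving : ∀ {W} → EdgeClosed A W → DiamAtMost A W 3 → DistancePreserving base A W P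
  base-distance-preserving closed diam = distance-preserving base-edge pull
    where
    pull : ShortWalksPullBack base A _ P
    pull D k<d = short-base-walk closed (walk-source (proj₁ D)) (≤-pred (≤-trans k<d (dist-≤-diam diam D)))

  bar-distance-preserving : ∀ {W} → DiamAtMost (complement A) W 2 → DistancePreserving bar (complement A) W P
  bar-distance-preserving diam = distance-preserving bar-edge pull
    where
    pull : ShortWalksPullBack bar (complement A) _ P
    pull {k = zero} D _ w with bar-injective (walk₀ w)
    ... | refl = 0 , z≤n , here (walk-source (proj₁ D))
    pull {x} {y} {k = suc zero} D _ w =
      1 , ≤-refl , step (walk-source (proj₁ D)) (trans (sym (P-bar-bar x y)) (walk₁ w))
                          (here (walk-target (proj₁ D)))
    pull {k = suc (suc _)} D k<d _ with ≤-trans k<d (dist-≤-diam diam D)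
    ... | s≤s (s≤s ())

  -- For u isolated in G and v ≠ u, the vertices u and v are at distance 3 in
  -- G Ḡ: they share no neighbour, since u's only neighbour is ū.
  isolated-far : ∀ {u v} → (∀ y → A u y ≡ false) → u ≢ v → ∀ k → k < 3 → ¬ Walk P ⊤ (base u) (base v) k
  isolated-far isolated u≢v zero _ w = u≢v (base-injective (walk₀ w))
  isolated-far {u} {v} isolated u≢v (suc zero) _ w
    with trans (sym (isolated v)) (trans (sym (P-base-base u v)) (walk₁ w))
  ... | ()
  isolated-far {u} {v} isolated u≢v (suc (suc zero)) _ w with walk₂ w
  ... | i , e₁ , e₂ =
    u≢v (common-neighbour (splitAt n i) (trans (sym (P-base-any u i)) e₁) (trans (sym (P-any-base i v)) e₂))
    where
    common-neighbour : (s : Fin n ⊎ Fin n) →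
      prismAdj A (inj₁ u) s ≡ true → prismAdj A s (inj₁ v) ≡ true → u ≡ v
    common-neighbour (inj₁ m) e _ with trans (sym (isolated m)) e
    ... | ()
    common-neighbour (inj₂ m) e e′ = trans (isYes⁻ (u ≟ m) e) (isYes⁻ (m ≟ v) e′)
  isolated-far _ _ (suc (suc (suc _))) (s≤s (s≤s (s≤s ())))

  module _ {K : Subset (n + n)} (convK : Convex P ⊤ K) where

    -- By isolated-far, u ū v̄ v is a shortest path, so ū and v̄ lie in every convex
    -- set containing u and v.
    isolated-step : ∀ {u v} → (∀ y → A u y ≡ false) → u ≢ v →
      base u ∈ K → base v ∈ K → bar u ∈ K × bar v ∈ K
    isolated-step {u} {v} isolated u≢v u∈K v∈K =
      convex-geodesic convK u∈K v∈K (step ∈⊤ (base-bar-edge u) (here ∈⊤)) ūv D ,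
      convex-geodesic convK u∈K v∈K (step ∈⊤ (base-bar-edge u) (step ∈⊤ ūv̄ (here ∈⊤)))
                                    (step ∈⊤ (bar-base-edge v) (here ∈⊤)) D
      where
      ūv̄ : P (bar u) (bar v) ≡ true
      ūv̄ rewrite P-bar-bar u v | isolated v | isNo⁺ (u ≟ v) u≢v = refl
      ūv : Walk P ⊤ (bar u) (base v) 2
      ūv = step ∈⊤ ūv̄ (step ∈⊤ (bar-base-edge v) (here ∈⊤))
      D : Dist P ⊤ (base u) (base v) 3
      D = step ∈⊤ (base-bar-edge u) ūv , isolated-far isolated u≢v

    -- For an edge w a of a loopless G, the path w a ā is shortest, so a lies in every
    -- convex set containing w and ā.
    edge-step : (∀ x → A x x ≡ false) → ∀ {w a} → A w a ≡ true → base w ∈ K → bar a ∈ K → base a ∈ K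
    edge-step loopless {w} {a} e w∈K ā∈K =
      convex-geodesic convK w∈K ā∈K (step ∈⊤ (base-edge w a e) (here ∈⊤)) (step ∈⊤ (base-bar-edge a) (here ∈⊤))
        (step ∈⊤ (base-edge w a e) (step ∈⊤ (base-bar-edge a) (here ∈⊤)) , not-adjacent)
      where
      not-adjacent : ∀ k → k < 2 → ¬ Walk P ⊤ (base w) (bar a) k
      not-adjacent zero _ wk = base≢bar (walk₀ wk)
      not-adjacent (suc zero) _ wk with isYes⁻ (w ≟ a) (trans (sym (P-base-bar w a)) (walk₁ wk))
      ... | refl with trans (sym (loopless w)) e
      ...   | ()
      not-adjacent (suc (suc _)) (s≤s (s≤s ()))

    walk-step : (∀ x → A x x ≡ false) → ∀ {W} → (∀ {y} → y ∈ W → bar y ∈ K) →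
      ∀ {w v k} → Walk A W w v k → base w ∈ K → base v ∈ K
    walk-step _ _ (here _) w∈K = w∈K
    walk-step loopless bar∈K (step _ e rest) w∈K =
      walk-step loopless bar∈K rest (edge-step loopless e w∈K (bar∈K (walk-source rest)))

module Hulls {n : ℕ} (A : Adjacency n) (C : Subset n)
  (loopless : ∀ x → A x x ≡ false)
  (closed : EdgeClosed A C)
  (connected : ∀ (x y : Fin n) → x ∈ C → y ∈ C → ∃ λ k → Walk A C x y k)
  (isolated : ∀ (x y : Fin n) → x ∉ C → A x y ≡ false)
  {u₀ c₀ : Fin n} (u₀∉C : u₀ ∉ C) (c₀∈C : c₀ ∈ C)
  where

  open Prism A

  isolated-at : ∀ {u} → u ∉ C → ∀ y → A u y ≡ false
  isolated-at u∉C y = isolated _ y u∉C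

  apart : ∀ {u v} → u ∉ C → v ∈ C → u ≢ v
  apart u∉C v∈C refl = u∉C v∈C

  -- S together with all isolated vertices, placed in the G-half of G Ḡ.
  lift : Subset n → Subset (n + n)
  lift S = (S ∪ ∁ C) ++ ⊥

  ∣lift∣≤ : ∀ S → ∣ lift S ∣ ≤ ∣ S ∣ + ∣ ∁ C ∣
  ∣lift∣≤ S = subst (_≤ ∣ S ∣ + ∣ ∁ C ∣) (sym (∣p++⊥∣≡∣p∣ (S ∪ ∁ C))) (∣p∪q∣≤∣p∣+∣q∣ S (∁ C))

  lift-⊇-S : ∀ S {x} → x ∈ S → base x ∈ lift S
  lift-⊇-S S x∈S = ∈-++ˡ (S ∪ ∁ C) ⊥ (x∈p∪q⁺ (inj₁ x∈S))

  lift-⊇-isolated : ∀ S {x} → x ∉ C → base x ∈ lift S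
  lift-⊇-isolated S x∉C = ∈-++ˡ (S ∪ ∁ C) ⊥ (x∈p∪q⁺ (inj₂ (x∉p⇒x∈∁p x∉C)))

  -- A convex set containing the G-copy of every vertex is everything: each x̄
  -- is reached by isolated-step from a pair (isolated vertex, vertex of C).
  convex-base-full : ∀ {K} → Convex P ⊤ K →
    (∀ {x} → x ∈ C → base x ∈ K) → (∀ {x} → x ∉ C → base x ∈ K) → ∀ i → i ∈ K
  convex-base-full convK inC outC = prism-cover base∈K bar∈K
    where
    base∈K : ∀ x → base x ∈ _
    base∈K x with x ∈? C
    ... | yes x∈C = inC x∈C
    ... | no x∉C = outC x∉C
    bar∈K : ∀ x → bar x ∈ _
    bar∈K x with x ∈? C
    ... | yes x∈C = proj₂ (isolated-step convK (isolated-at u₀∉C) (apart u₀∉C x∈C) (outC u₀∉C) (inC x∈C))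
    ... | no x∉C = proj₁ (isolated-step convK (isolated-at x∉C) (apart x∉C c₀∈C) (outC x∉C) (inC c₀∈C))

  lift-hull-G : DiamAtMost A C 3 → ∀ {S} → S ⊆ C → IsHullSet A C S → IsHullSet P ⊤ (lift S)
  lift-hull-G diam {S} S⊆C hull K _ lift⊆K convK {i} _ =
    convex-base-full convK
      (hull-image base-edge (base-distance-preserving closed diam) S⊆C hull convK
                  (λ s∈S → lift⊆K (lift-⊇-S S s∈S)))
      (λ x∉C → lift⊆K (lift-⊇-isolated S x∉C)) i

  -- Lifting a hull set of Ḡ₁ = Ā[C] gives a hull set of G Ḡ (needs diam(Ḡ₁) ≤ 2):
  -- first all x̄ (x ∈ C) enter K, then the G-copies spread from some s ∈ S along G₁.
  lift-hull-Ḡ : DiamAtMost (complement A) C 2 → ∀ {S} → S ⊆ C → IsHullSet (complement A) C S →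
    IsHullSet P ⊤ (lift S)
  lift-hull-Ḡ diam {S} S⊆C hull K _ lift⊆K convK {i} _ =
    convex-base-full convK inC (λ x∉C → lift⊆K (lift-⊇-isolated S x∉C)) i
    where
    u₀∈K : base u₀ ∈ K
    u₀∈K = lift⊆K (lift-⊇-isolated S u₀∉C)
    s∈K : ∀ {s} → s ∈ S → base s ∈ K
    s∈K s∈S = lift⊆K (lift-⊇-S S s∈S)
    s̄∈K : ∀ {s} → s ∈ S → bar s ∈ K
    s̄∈K s∈S = proj₂ (isolated-step convK (isolated-at u₀∉C) (apart u₀∉C (S⊆C s∈S)) u₀∈K (s∈K s∈S))
    x̄∈K : ∀ {x} → x ∈ C → bar x ∈ K
    x̄∈K = hull-image bar-edge (bar-distance-preserving diam) S⊆C hull convK s̄∈K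
    inC : ∀ {x} → x ∈ C → base x ∈ K
    inC {x} x∈C with hull-nonempty hull c₀∈C
    ... | s , s∈S = walk-step convK loopless x̄∈K (proj₂ (connected s x (S⊆C s∈S) x∈C)) (s∈K s∈S)

corollary2 : ∀ (n : ℕ) (A : Adjacency n) (C : Subset n) (t : ℕ) →
    IsSimple A →
    OneNontrivialComponent A C t → 0 < t →
    DiamAtMost A C 3 → DiamAtMost (complement A) C 2 →
    ∀ (h₁ h₂ hp : ℕ) →
    IsHullNumber A C h₁ → IsHullNumber (complement A) C h₂ →
    IsHullNumber (complementaryPrism A) ⊤ hp →
    hp ≤ (h₁ ⊓ h₂) + t
corollary2 n A C t (_ , loopless) (((c₀ , c₀∈C) , connected , no-edge-out) , _ , isolated , ∣∁C∣≡t) 0<t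
           diam₁ diam₂ h₁ h₂ hp (hull₁ , _) (hull₂ , _) (_ , hp-minimal)
  with positive⇒nonempty (∁ C) (subst (0 <_) (sym ∣∁C∣≡t) 0<t)
... | u₀ , u₀∈∁C = by-min (≤-total h₁ h₂)
  where
  open Hulls A C loopless (no-edge-out⇒closed no-edge-out) connected isolated (x∈∁p⇒x∉p u₀∈∁C) c₀∈C
  bound : ∀ {S h} → ∣ S ∣ ≡ h → IsHullSet (complementaryPrism A) ⊤ (lift S) → hp ≤ h + t
  bound {S} ∣S∣≡h lift-hull = ≤-trans (hp-minimal (lift S) (λ _ → ∈⊤) lift-hull)
    (subst₂ (λ a b → ∣ lift S ∣ ≤ a + b) ∣S∣≡h ∣∁C∣≡t (∣lift∣≤ S))
  bound₁ : hp ≤ h₁ + t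
  bound₁ = let (S , S⊆C , hull , ∣S∣≡h₁) = hull₁ in bound ∣S∣≡h₁ (lift-hull-G diam₁ S⊆C hull)
  bound₂ : hp ≤ h₂ + t
  bound₂ = let (S , S⊆C , hull , ∣S∣≡h₂) = hull₂ in bound ∣S∣≡h₂ (lift-hull-Ḡ diam₂ S⊆C hull)
  by-min : h₁ ≤ h₂ ⊎ h₂ ≤ h₁ → hp ≤ (h₁ ⊓ h₂) + t
  by-min (inj₁ h₁≤h₂) rewrite m≤n⇒m⊓n≡m h₁≤h₂ = bound₁
  by-min (inj₂ h₂≤h₁) rewrite m≥n⇒m⊓n≡n h₂≤h₁ = bound₂
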